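{- Let $(S,A,\to)$ be an LTS. The function $f:\mathrm{Rel}_S\to\mathrm{Rel}_S$ given by $f(\mathcal{R})={\succsim}\,\mathcal{R}\,{\precsim}$ (relational composition of branching expansion, $\mathcal{R}$, and the converse of branching expansion) is $b$-respectful, where $b$ is the branching bisimulation functional.
   Context: $\mathrm{Rel}_S$ is the set of binary relations on $S$; relational composition $\mathcal{R}\mathcal{S}=\{(P,Q)\mid\exists X.\,P\mathcal{R}X,\ X\mathcal{S}Q\}$. $\Rightarrow$ is the reflexive transitive closure of $\xrightarrow{\tau}$; $P\xrightarrow{(\alpha)}P'$ means $P\xrightarrow{\alpha}P'$, or $\alpha=\tau$ and $P=P'$. Define $s_{br}(\mathcal{R})=\{(P,Q)\mid$ for all $P',\alpha$, if $P\xrightarrow{\alpha}P'$ then there exist $Q',Q''$ with $Q\Rightarrow Q'\xrightarrow{(\alpha)}Q''$, $P\mathcal{R}Q'$ and $P'\mathcal{R}Q''\}$, and $b(\mathcal{R})=s_{br}(\mathcal{R})\cap (s_{br}(\mathcal{R}^{ -1}))^{ -1}$. Define $e(\mathcal{R})=\{(P,Q)\mid$ for all $P',\alpha$: if $P\xrightarrow{\alpha}P'$ then there is $Q'$ with $Q\xrightarrow{(\alpha)}Q'$ and $P'\mathcal{R}Q'$; and for all $Q',\alpha$: if $Q\xrightarrow{\alpha}Q'$ then there are $P',P''$ with $P\Rightarrow P'\xrightarrow{\alpha}P''$, $P'\mathcal{R}Q$ and $P''\mathcal{R}Q'\}$. Branching expansion ${\succsim}$ is the greatest fixed point of the monotone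 map $e$, and ${\precsim}$ is its converse. A monotone $f$ is $b$-respectful if for every relation $\mathcal{R}$, $f(b(\mathcal{R})\cap\mathcal{R})\subseteq b(f(\mathcal{R}))\cap f(\mathcal{R})$. -}

module Defs where

open import Level using (Level; _⊔_; suc; 0ℓ)
open import Data.Product using (Σ; ∃; _×_; _,_)
open import Data.Sum using (_⊎_)
open import Relation.Binary.PropositionalEquality using (_≡_)
open import Relation.Binary.Construct.Closure.ReflexiveTransitive using (Star)

record LTS : Set₁ where
  field
    State  : Set
    Action : Set
    τ      : Action
    _—[_]→_ : State → Action → State → Set

RelS : (L : LTS) → (ℓ : Level) → Set (suc ℓ)
RelS L ℓ = LTS.State L → LTS.State L → Set ℓ

module _ (L : LTS) where
  open LTS L

  _⊆ᵣ_ : ∀ {a b} → RelS L a → RelS L b → Set (a ⊔ b)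
  R ⊆ᵣ S' = ∀ {P Q} → R P Q → S' P Q

  _∩ᵣ_ : ∀ {a b} → RelS L a → RelS L b → RelS L (a ⊔ b)
  (R ∩ᵣ S') P Q = R P Q × S' P Q

  _⁻¹ : ∀ {a} → RelS L a → RelS L a
  (R ⁻¹) P Q = R Q P

  _⨾_ : ∀ {a b} → RelS L a → RelS L b → RelS L (a ⊔ b)
  (R ⨾ S') P Q = ∃ λ X → R P X × S' X Q

  _τ→_ : State → State → Set
  P τ→ Q = P —[ τ ]→ Q

  _⇒_ : State → State → Set
  _⇒_ = Star _τ→_

  _—[[_]]→_ : State → Action → State → Set
  P —[[ α ]]→ P' = (P —[ α ]→ P') ⊎ ((α ≡ τ) × (P ≡ P'))

  s-br : ∀ {ℓ} → RelS L ℓ → RelS L ℓ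
  s-br R P Q = ∀ {P' α} → P —[ α ]→ P' →
    ∃ λ Q' → ∃ λ Q'' → (Q ⇒ Q') × (Q' —[[ α ]]→ Q'') × R P Q' × R P' Q''

  b : ∀ {ℓ} → RelS L ℓ → RelS L ℓ
  b R = s-br R ∩ᵣ ((s-br (R ⁻¹)) ⁻¹)

  e : ∀ {ℓ} → RelS L ℓ → RelS L ℓ
  e R P Q =
    (∀ {P' α} → P —[ α ]→ P' → ∃ λ Q' → (Q —[[ α ]]→ Q') × R P' Q')
    × (∀ {Q' α} → Q —[ α ]→ Q' →
         ∃ λ P' → ∃ λ P'' → (P ⇒ P') × (P' —[ α ]→ P'') × R P' Q × R P'' Q')

  -- branching expansion ≿ : greatest fixed point of the monotone map e,
  -- given (Knaster–Tarski) as the union of all post-fixed points of e.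
  _≿_ : RelS L (suc 0ℓ)
  P ≿ Q = Σ (RelS L 0ℓ) λ R → (R ⊆ᵣ e R) × R P Q

  _≾_ : RelS L (suc 0ℓ)
  _≾_ = _≿_ ⁻¹

  fexp : RelS L 0ℓ → RelS L (suc 0ℓ)
  fexp R = ((_≿_) ⨾ R) ⨾ (_≾_)

  -- f is b-respectful (f is monotone by construction)
  b-respectful : (RelS L 0ℓ → RelS L (suc 0ℓ)) → Set₁
  b-respectful f = ∀ (R : RelS L 0ℓ) →
    f (b R ∩ᵣ R) ⊆ᵣ (b (f R) ∩ᵣ f R)

module Submission where

-- Let P ≿ X, X (b(R) ∩ R) Y and Y ≾ Q.  A move of P is answered
-- strongly by X (expansion is one-sided strong), X's move is answered by a
-- weak branching move Y ⇒ Y' —(α)→ Y'' (since X b(R) Y), and this weak move is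
-- transported back along Q ≿ Y: every τ-step of Y is matched by a (possibly
-- longer) weak step of Q, and every visible step of Y by a weak branching step
-- of Q.  Composing the three answers gives the s-br clause for f(R) at (P, Q).
--
-- The converse clause of b is the same lemma
-- applied to R⁻¹, after noting f(R⁻¹) ⊆ f(R)⁻¹ and that s-br is monotone.

open import Defs
open import Level using (0ℓ)
open import Data.Product using (∃; _×_; _,_; proj₁; proj₂)
open import Data.Sum using (inj₁; inj₂)
open import Relation.Binary.PropositionalEquality using (refl)
open import Relation.Binary.Construct.Closure.ReflexiveTransitive using (ε; _◅_; _◅◅_)

module UpToExpansion (L : LTS) where

  -- ≿ is a post-fixed point of e: the witness relation R ⊆ e R of a pair
  -- P ≿ Q also witnesses every pair reached by one unfolding of e.
  ≿-unfold : _⊆ᵣ_ L (_≿_ L) (e L (_≿_ L))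
  ≿-unfold (R , R⊆eR , rPQ) with R⊆eR rPQ
  ... | forth , back =
    (λ st → let (Q' , sQ , r') = forth st in Q' , sQ , (R , R⊆eR , r'))
    , (λ st → let (P' , P'' , w , sP , r₁ , r₂) = back st
              in P' , P'' , w , sP , (R , R⊆eR , r₁) , (R , R⊆eR , r₂))

  ≿-silent : ∀ {P X X'} → _≿_ L P X → _⇒_ L X X' →
    ∃ λ P' → _⇒_ L P P' × _≿_ L P' X'
  ≿-silent p ε = _ , ε , p
  ≿-silent p (t ◅ w) with proj₂ (≿-unfold p) t
  ... | P₁ , P₂ , w₁ , s , _ , p₂ with ≿-silent p₂ w
  ... | P₃ , w₂ , p₃ = P₃ , (w₁ ◅◅ (s ◅ w₂)) , p₃

  ≿-transfer : ∀ {P X X' X'' α} → _≿_ L P X → _⇒_ L X X' → _—[[_]]→_ L X' α X'' →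
    ∃ λ P' → ∃ λ P'' →
      _⇒_ L P P' × _—[[_]]→_ L P' α P'' × _≿_ L P' X' × _≿_ L P'' X''
  ≿-transfer p w s with ≿-silent p w
  ≿-transfer p w (inj₂ (refl , refl)) | P' , w₁ , p₁ =
    P' , P' , w₁ , inj₂ (refl , refl) , p₁ , p₁
  ≿-transfer p w (inj₁ s) | P' , w₁ , p₁ with proj₂ (≿-unfold p₁) s
  ... | P₁ , P₂ , w₂ , s₂ , q₁ , q₂ = P₁ , P₂ , (w₁ ◅◅ w₂) , inj₁ s₂ , q₁ , q₂

  s-br-mono : ∀ {ℓ} {R S : RelS L ℓ} → _⊆ᵣ_ L R S → _⊆ᵣ_ L (s-br L R) (s-br L S)
  s-br-mono R⊆S sim st with sim st
  ... | Q' , Q'' , w , s , r₁ , r₂ = Q' , Q'' , w , s , R⊆S r₁ , R⊆S r₂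

  fexp-mono : {R S : RelS L 0ℓ} → _⊆ᵣ_ L R S → _⊆ᵣ_ L (fexp L R) (fexp L S)
  fexp-mono R⊆S (Y , (X , pX , rXY) , qY) = Y , (X , pX , R⊆S rXY) , qY

  fexp-converse : (R : RelS L 0ℓ) → _⊆ᵣ_ L (fexp L (_⁻¹ L R)) (_⁻¹ L (fexp L R))
  fexp-converse R (Y , (X , pX , rYX) , qY) = X , (Y , qY , rYX) , pX

  s-br-fexp : ∀ {R P X Y Q} → _≿_ L P X → s-br L R X Y → R X Y → _≿_ L Q Y →
    s-br L (fexp L R) P Q
  s-br-fexp {X = X} {Y} {Q} pX sim rXY qY st with proj₁ (≿-unfold pX) st
  ... | X' , inj₂ (refl , refl) , p' =
    Q , Q , ε , inj₂ (refl , refl) , (Y , (X , pX , rXY) , qY) , (Y , (X , p' , rXY) , qY)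
  ... | X' , inj₁ sX , p' with sim sX
  ... | Y' , Y'' , wY , sY , r₁ , r₂ with ≿-transfer qY wY sY
  ... | Q' , Q'' , wQ , sQ , q₁ , q₂ =
    Q' , Q'' , wQ , sQ , (Y' , (X , pX , r₁) , q₁) , (Y'' , (X' , p' , r₂) , q₂)

lemma11 : (L : LTS) → b-respectful L (fexp L)
lemma11 L R {P} {Q} related@(Y , (X , pX , (bXY , rXY)) , qY) =
  (forth , back) , fexp-mono proj₂ related
  where
  open UpToExpansion L
  forth : s-br L (fexp L R) P Q
  forth = s-br-fexp pX (proj₁ bXY) rXY qY
  back : s-br L (_⁻¹ L (fexp L R)) Q P
  back = s-br-mono (fexp-converse R) (s-br-fexp {R = _⁻¹ L R} qY (proj₂ bXY) rXY pX)
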